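{- Let $G$ be a graph with a twin class $X$ of size at least $4$. Then for every $x\in X$, the lettericity of $G$ equals the lettericity of $G\setminus\{x\}$.
   Context: Two vertices $x,y$ of an undirected graph $G$ are twins if they have the same neighbourhood in $V(G)\setminus\{x,y\}$; this is an equivalence relation and a twin class is one of its equivalence classes. A decoder is a directed graph $D=(\Sigma,A)$ (loops allowed) on a finite alphabet. An $n$-vertex graph $G=(V,E)$ is a letter graph over $D$ if there exist $\ell:V\to\Sigma$ and a bijection $c:V\to[n]$ such that two distinct vertices $u,v$ are adjacent iff either $(\ell(u),\ell(v))\in A$ and $c(u)<c(v)$, or $(\ell(v),\ell(u))\in A$ and $c(v)<c(u)$. The lettericity of $G$ is the least $|\Sigma|$ of a decoder over which $G$ is a letter graph. -}

module Defs where

open import Data.Nat using (ℕ; suc; _≤_)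
open import Data.Fin using (Fin; punchIn) renaming (_<_ to _<ᶠ_)
open import Data.Fin.Subset using (Subset; _∈_; ∣_∣)
open import Data.Bool using (Bool; true; false)
open import Data.Product using (Σ; _×_; ∃-syntax)
open import Data.Sum using (_⊎_)
open import Relation.Binary.PropositionalEquality using (_≡_; _≢_)
open import Relation.Nullary using (¬_)
open import Function.Definitions using (Bijective)
open import Function.Bundles using (_⇔_)

record Graph (n : ℕ) : Set where
  field
    adj   : Fin n → Fin n → Bool
    sym   : ∀ u v → adj u v ≡ adj v u
    irrefl : ∀ u → adj u u ≡ false
open Graph public

delete : ∀ {m} → Graph (suc m) → Fin (suc m) → Graph m
delete G x = record
  { adj = λ u v → adj G (punchIn x u) (punchIn x v)
  ; sym = λ u v → sym G (punchIn x u) (punchIn x v)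
  ; irrefl = λ u → irrefl G (punchIn x u)
  }

Twins : ∀ {n} → Graph n → Fin n → Fin n → Set
Twins G x y = ∀ z → z ≢ x → z ≢ y → adj G x z ≡ adj G y z

IsTwinClass : ∀ {n} → Graph n → Subset n → Set
IsTwinClass G X =
  (∃[ x ] x ∈ X)
  × (∀ x y → x ∈ X → y ∈ X → Twins G x y)
  × (∀ x y → x ∈ X → Twins G x y → y ∈ X)

-- A decoder on the alphabet Fin k: a directed graph (loops allowed).
Decoder : ℕ → Set
Decoder k = Fin k → Fin k → Bool

IsLetterGraphOver : ∀ {n k} → Graph n → Decoder k → Set
IsLetterGraphOver {n} {k} G D =
  Σ (Fin n → Fin k) λ ℓ →
  Σ (Fin n → Fin n) λ c →
    Bijective _≡_ _≡_ c ×
    (∀ u v → u ≢ v →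
      (adj G u v ≡ true) ⇔
      ((D (ℓ u) (ℓ v) ≡ true × c u <ᶠ c v) ⊎ (D (ℓ v) (ℓ u) ≡ true × c v <ᶠ c u)))

IsLetterGraph : ∀ {n} → Graph n → ℕ → Set
IsLetterGraph G k = Σ (Decoder k) λ D → IsLetterGraphOver G D

HasLettericity : ∀ {n} → Graph n → ℕ → Set
HasLettericity G k = IsLetterGraph G k × (∀ j → IsLetterGraph G j → k ≤ j)

-- Deleting a vertex keeps a letter representation: restrict the labelling
-- and the positions.  Conversely, represent G - x and sort three further
-- members of the twin class by position, u₁ < u₂ < u₃.  If the letter b of
-- u₂ is carried by another vertex v, then the loop D(b,b) is forced to be
-- adj(u₁,u₂): compare v with u₃ when v precedes u₂ and with u₁ otherwise.
-- Hence the loop at b can be set to adj(u₁,u₂) = adj(x,u₂) without changing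
-- the graph, and then x, a twin of u₂, is inserted with letter b directly
-- after u₂.  So G and G - x are letter graphs over the same alphabets.
module Submission where

open import Defs
open import Data.Nat using (ℕ; suc; _≤_)
open import Data.Fin using (Fin)
open import Data.Fin.Subset using (Subset; _∈_; ∣_∣)
open import Function.Bundles using (_⇔_)

open import Data.Bool using (Bool; true; false)
open import Data.Fin using (zero; suc; punchIn; punchOut)
  renaming (_<_ to _<ᶠ_; _≤_ to _≤ᶠ_)
open import Data.Fin.Permutation
  using (Permutation; _⟨$⟩ʳ_; remove; insert; punchIn-permute; insert-punchIn)
open import Data.Fin.Properties
  using (_≟_; <-cmp; <-irrefl; <-asym; <-trans; <⇒≢; ≤∧≢⇒<; suc-injective;
         punchIn-injective; punchInᵢ≢i; punchIn-mono-≤; punchIn-cancel-≤;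
         punchIn-punchOut; punchOut-injective)
open import Data.Fin.Subset using (_-_)
open import Data.Fin.Subset.Properties using (p─⊥≡p; nonempty?; Empty-unique; ∣⊥∣≡0)
import Data.Nat as ℕ
import Data.Nat.Properties as ℕ
open import Data.Product as Product using (_×_; _,_; proj₁; proj₂; ∃; ∃₂)
open import Data.Sum as Sum using (_⊎_; inj₁; inj₂; [_,_])
open import Data.Vec using (_∷_; here; there)
open import Data.Vec.Functional using (insertAt)
open import Data.Vec.Functional.Properties using (insertAt-lookup; insertAt-punchIn)
open import Function using (_∘_)
open import Function.Bundles using (Bijection; mk⇔; mk⤖; Equivalence)
open import Function.Construct.Composition using (_⇔-∘_)
open import Function.Construct.Symmetry using (⇔-sym)
open import Function.Properties.Bijection using (⤖⇒↔)
open import Function.Properties.Inverse using (↔⇒⤖)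
open import Relation.Binary.Definitions using (tri<; tri≈; tri>)
open import Relation.Binary.PropositionalEquality as ≡
  using (_≡_; _≢_; refl; trans; cong; subst; subst₂)
open import Relation.Nullary using (yes; no)
open import Relation.Nullary.Negation using (contradiction)

private
  variable
    m n k : ℕ

true⇔true⇒≡ : ∀ {a b : Bool} → (a ≡ true ⇔ b ≡ true) → a ≡ b
true⇔true⇒≡ {false} {false} _   = refl
true⇔true⇒≡ {false} {true}  a⇔b = Equivalence.from a⇔b refl
true⇔true⇒≡ {true}  {false} a⇔b = ≡.sym (Equivalence.to a⇔b refl)
true⇔true⇒≡ {true}  {true}  _   = refl

≢⇒<⊎> : ∀ {i j : Fin n} → i ≢ j → i <ᶠ j ⊎ j <ᶠ i
≢⇒<⊎> {i = i} {j} i≢j with <-cmp i j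
... | tri< i<j _ _ = inj₁ i<j
... | tri≈ _ i≡j _ = contradiction i≡j i≢j
... | tri> _ _ j<i = inj₂ j<i

punchIn-mono-< : ∀ (i : Fin (suc n)) {a b} → a <ᶠ b → punchIn i a <ᶠ punchIn i b
punchIn-mono-< i a<b =
  ≤∧≢⇒< (punchIn-mono-≤ i _ _ (ℕ.<⇒≤ a<b)) (<⇒≢ a<b ∘ punchIn-injective i _ _)

punchIn-cancel-< : ∀ (i : Fin (suc n)) {a b} → punchIn i a <ᶠ punchIn i b → a <ᶠ b
punchIn-cancel-< i lt =
  ≤∧≢⇒< (punchIn-cancel-≤ i _ _ (ℕ.<⇒≤ lt)) (<⇒≢ lt ∘ cong (punchIn i))

<-punchIn⇒≤ : ∀ (i : Fin (suc n)) t → i <ᶠ punchIn i t → i ≤ᶠ t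
<-punchIn⇒≤ zero    t       _         = ℕ.z≤n
<-punchIn⇒≤ (suc i) (suc t) (ℕ.s≤s lt) = ℕ.s≤s (<-punchIn⇒≤ i t lt)

punchIn-<⇒< : ∀ (i : Fin (suc n)) t → punchIn i t <ᶠ i → t <ᶠ i
punchIn-<⇒< (suc i) zero    _          = ℕ.s≤s ℕ.z≤n
punchIn-<⇒< (suc i) (suc t) (ℕ.s≤s lt) = ℕ.s≤s (punchIn-<⇒< i t lt)

data PunchInView (x : Fin (suc n)) : Fin (suc n) → Set where
  at      : PunchInView x x
  punched : ∀ v → PunchInView x (punchIn x v)

punchInView : ∀ (x w : Fin (suc n)) → PunchInView x w
punchInView x w with x ≟ w
... | yes refl = at
... | no x≢w   = subst (PunchInView x) (punchIn-punchOut x≢w) (punched _)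

insert-lookup : ∀ i j (π : Permutation m n) → insert i j π ⟨$⟩ʳ i ≡ j
insert-lookup i j π with i ≟ i
... | yes _  = refl
... | no i≢i = contradiction refl i≢i

x∈p-y⁻ : ∀ {p : Subset n} {x y} → x ∈ p - y → x ∈ p × x ≢ y
x∈p-y⁻ {p = _ ∷ p} {suc x} {zero}  (there x∈p) = there (subst (x ∈_) (p─⊥≡p p) x∈p) , λ ()
x∈p-y⁻ {p = _ ∷ p} {zero}  {suc y} here        = here , λ ()
x∈p-y⁻ {p = _ ∷ p} {suc x} {suc y} (there x∈p-y) =
  Product.map there (_∘ suc-injective) (x∈p-y⁻ x∈p-y)

∣p∣≤1+∣p-x∣ : ∀ (p : Subset n) x → ∣ p ∣ ≤ suc ∣ p - x ∣
∣p∣≤1+∣p-x∣ (true  ∷ p) zero    = ℕ.s≤s (ℕ.≤-reflexive (cong ∣_∣ (≡.sym (p─⊥≡p p))))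
∣p∣≤1+∣p-x∣ (false ∷ p) zero    = ℕ.m≤n⇒m≤1+n (ℕ.≤-reflexive (cong ∣_∣ (≡.sym (p─⊥≡p p))))
∣p∣≤1+∣p-x∣ (true  ∷ p) (suc x) = ℕ.s≤s (∣p∣≤1+∣p-x∣ p x)
∣p∣≤1+∣p-x∣ (false ∷ p) (suc x) = ∣p∣≤1+∣p-x∣ p x

pick-member : ∀ (p : Subset n) → suc k ≤ ∣ p ∣ → ∃ λ a → a ∈ p × k ≤ ∣ p - a ∣
pick-member {n} p k<∣p∣ with nonempty? p
... | yes (a , a∈p) = a , a∈p , ℕ.s≤s⁻¹ (ℕ.≤-trans k<∣p∣ (∣p∣≤1+∣p-x∣ p a))
... | no p-empty    =
  contradiction (subst (_ ≤_) (trans (cong ∣_∣ (Empty-unique p-empty)) (∣⊥∣≡0 n)) k<∣p∣) λ ()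

three-members : ∀ (p : Subset n) → 3 ≤ ∣ p ∣ →
  ∃ λ a → ∃ λ b → ∃ λ c → a ∈ p × b ∈ p × c ∈ p × a ≢ b × b ≢ c × a ≢ c
three-members p 3≤∣p∣ =
  let (a , a∈p , 2≤∣p-a∣)     = pick-member p 3≤∣p∣
      (b , b∈p-a , 1≤∣p-a-b∣) = pick-member (p - a) 2≤∣p-a∣
      (c , c∈p-a-b , _)       = pick-member (p - a - b) 1≤∣p-a-b∣
      (b∈p , b≢a)   = x∈p-y⁻ b∈p-a
      (c∈p-a , c≢b) = x∈p-y⁻ c∈p-a-b
      (c∈p , c≢a)   = x∈p-y⁻ c∈p-a
  in a , b , c , a∈p , b∈p , c∈p , b≢a ∘ ≡.sym , c≢b ∘ ≡.sym , c≢a ∘ ≡.sym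

three-others : ∀ (X : Subset (suc m)) x → 4 ≤ ∣ X ∣ →
  ∃ λ a → ∃ λ b → ∃ λ c →
    punchIn x a ∈ X × punchIn x b ∈ X × punchIn x c ∈ X × a ≢ b × b ≢ c × a ≢ c
three-others {m} X x 4≤∣X∣ =
  let (a , b , c , a∈ , b∈ , c∈ , a≢b , b≢c , a≢c) =
        three-members (X - x) (ℕ.s≤s⁻¹ (ℕ.≤-trans 4≤∣X∣ (∣p∣≤1+∣p-x∣ X x)))
  in lower a∈ , lower b∈ , lower c∈ , lower-∈ a∈ , lower-∈ b∈ , lower-∈ c∈ ,
     lower-≢ a∈ b∈ a≢b , lower-≢ b∈ c∈ b≢c , lower-≢ a∈ c∈ a≢c
  where
  x≢ : ∀ {a} → a ∈ X - x → x ≢ a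
  x≢ a∈ = proj₂ (x∈p-y⁻ a∈) ∘ ≡.sym

  lower : ∀ {a} → a ∈ X - x → Fin m
  lower a∈ = punchOut (x≢ a∈)

  lower-∈ : ∀ {a} (a∈ : a ∈ X - x) → punchIn x (lower a∈) ∈ X
  lower-∈ a∈ = subst (_∈ X) (≡.sym (punchIn-punchOut _)) (proj₁ (x∈p-y⁻ a∈))

  lower-≢ : ∀ {a b} (a∈ : a ∈ X - x) (b∈ : b ∈ X - x) → a ≢ b → lower a∈ ≢ lower b∈
  lower-≢ a∈ b∈ a≢b = a≢b ∘ punchOut-injective (x≢ a∈) (x≢ b∈)

sort3 : ∀ {A : Set} {P : A → Set} (f : A → Fin n) {a b c} →
  P a → P b → P c → f a ≢ f b → f b ≢ f c → f a ≢ f c →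
  ∃ λ u₁ → ∃ λ u₂ → ∃ λ u₃ → P u₁ × P u₂ × P u₃ × f u₁ <ᶠ f u₂ × f u₂ <ᶠ f u₃
sort3 f {a} {b} {c} pa pb pc ab bc ac with ≢⇒<⊎> ab | ≢⇒<⊎> bc | ≢⇒<⊎> ac
... | inj₁ a<b | inj₁ b<c | _        = a , b , c , pa , pb , pc , a<b , b<c
... | inj₁ a<b | inj₂ c<b | inj₁ a<c = a , c , b , pa , pc , pb , a<c , c<b
... | inj₁ a<b | inj₂ c<b | inj₂ c<a = c , a , b , pc , pa , pb , c<a , a<b
... | inj₂ b<a | inj₁ b<c | inj₁ a<c = b , a , c , pb , pa , pc , b<a , a<c
... | inj₂ b<a | inj₁ b<c | inj₂ c<a = b , c , a , pb , pc , pa , b<c , c<a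
... | inj₂ b<a | inj₂ c<b | _        = c , b , a , pc , pb , pa , c<b , b<a

permute-injective : ∀ (π : Permutation m n) {a b} → π ⟨$⟩ʳ a ≡ π ⟨$⟩ʳ b → a ≡ b
permute-injective π = Bijection.injective (↔⇒⤖ π)

Oriented : ∀ {n k} → Decoder k → Fin k → Fin k → Fin n → Fin n → Set
Oriented D a b p q = (D a b ≡ true × p <ᶠ q) ⊎ (D b a ≡ true × q <ᶠ p)

oriented-< : ∀ (D : Decoder k) {a b} {p q : Fin n} → p <ᶠ q → Oriented D a b p q ⇔ (D a b ≡ true)
oriented-< D p<q = mk⇔ [ proj₁ , (λ (_ , q<p) → contradiction p<q (<-asym q<p)) ] (λ d → inj₁ (d , p<q))

oriented-swap : ∀ (D : Decoder k) {a b} {p q : Fin n} → Oriented D a b p q ⇔ Oriented D b a q p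
oriented-swap D = mk⇔ Sum.swap Sum.swap

record Represents (G : Graph n) (D : Decoder k) (ℓ : Fin n → Fin k) (π : Permutation n n) : Set where
  constructor represents
  field
    decode : ∀ u v → π ⟨$⟩ʳ u <ᶠ π ⟨$⟩ʳ v → adj G u v ≡ D (ℓ u) (ℓ v)

open Represents

module _ {G : Graph n} {D : Decoder k} where

  isLetterGraphOver⇒represents : IsLetterGraphOver G D → ∃₂ λ ℓ π → Represents G D ℓ π
  isLetterGraphOver⇒represents (ℓ , c , c-bijective , c-oriented) =
    ℓ , ⤖⇒↔ (mk⤖ c-bijective) , represents λ u v cu<cv →
      true⇔true⇒≡ (oriented-< D cu<cv ⇔-∘ c-oriented u v (λ { refl → <-irrefl refl cu<cv }))

  represents⇒isLetterGraphOver : ∀ {ℓ π} → Represents G D ℓ π → IsLetterGraphOver G D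
  represents⇒isLetterGraphOver {ℓ} {π} rep = ℓ , π ⟨$⟩ʳ_ , Bijection.bijective (↔⇒⤖ π) , oriented
    where
    oriented : ∀ u v → u ≢ v → (adj G u v ≡ true) ⇔ Oriented D (ℓ u) (ℓ v) (π ⟨$⟩ʳ u) (π ⟨$⟩ʳ v)
    oriented u v u≢v with <-cmp (π ⟨$⟩ʳ u) (π ⟨$⟩ʳ v)
    ... | tri< πu<πv _ _ rewrite decode rep u v πu<πv = ⇔-sym (oriented-< D πu<πv)
    ... | tri≈ _ πu≡πv _ = contradiction (permute-injective π πu≡πv) u≢v
    ... | tri> _ _ πv<πu rewrite sym G u v | decode rep v u πv<πu =
      oriented-swap D ⇔-∘ ⇔-sym (oriented-< D πv<πu)

represents-delete : ∀ {G : Graph (suc m)} {D : Decoder k} {ℓ π} → Represents G D ℓ π →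
  ∀ x → Represents (delete G x) D (ℓ ∘ punchIn x) (remove x π)
represents-delete {π = π} rep x = represents λ u v πu<πv → decode rep (punchIn x u) (punchIn x v)
  (subst₂ _<ᶠ_ (≡.sym (punchIn-permute π x u)) (≡.sym (punchIn-permute π x v))
    (punchIn-mono-< (π ⟨$⟩ʳ x) πu<πv))

withLoop : Decoder k → Fin k → Bool → Decoder k
withLoop D b ε c d with c ≟ b | d ≟ b
... | yes _ | yes _ = ε
... | _     | _     = D c d

withLoop-loop : ∀ (D : Decoder k) b ε → withLoop D b ε b b ≡ ε
withLoop-loop D b ε with b ≟ b
... | yes _  = refl
... | no b≢b = contradiction refl b≢b

withLoop-agrees : ∀ (D : Decoder k) {b ε c d} → (c ≡ b → d ≡ b → D b b ≡ ε) →
  withLoop D b ε c d ≡ D c d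
withLoop-agrees D {b} {ε} {c} {d} loop with c ≟ b | d ≟ b
... | yes refl | yes refl = ≡.sym (loop refl refl)
... | yes _    | no _     = refl
... | no _     | _        = refl

module _ {H : Graph n} {D : Decoder k} {ℓ : Fin n → Fin k} {π : Permutation n n}
         (rep : Represents H D ℓ π) where

  private
    pos : Fin n → Fin n
    pos = π ⟨$⟩ʳ_

    ordered⇒≢ : ∀ {u v} → pos u <ᶠ pos v → u ≢ v
    ordered⇒≢ pu<pv = <⇒≢ pu<pv ∘ cong pos

  represents-withLoop : ∀ {y ε} → (∀ v → v ≢ y → ℓ v ≡ ℓ y → D (ℓ y) (ℓ y) ≡ ε) →
    Represents H (withLoop D (ℓ y) ε) ℓ π
  represents-withLoop {y} {ε} forced = represents λ u v pu<pv →
    trans (decode rep u v pu<pv) (≡.sym (withLoop-agrees D (loop u v pu<pv)))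
    where
    loop : ∀ u v → pos u <ᶠ pos v → ℓ u ≡ ℓ y → ℓ v ≡ ℓ y → D (ℓ y) (ℓ y) ≡ ε
    loop u v pu<pv ℓu≡ℓy ℓv≡ℓy with u ≟ y
    ... | yes refl = forced v (ordered⇒≢ pu<pv ∘ ≡.sym) ℓv≡ℓy
    ... | no u≢y   = forced u u≢y ℓu≡ℓy

  repeated-letter-loop : ∀ {u₁ u₂ u₃} → Twins H u₁ u₂ → Twins H u₂ u₃ → Twins H u₁ u₃ →
    pos u₁ <ᶠ pos u₂ → pos u₂ <ᶠ pos u₃ →
    ∀ v → v ≢ u₂ → ℓ v ≡ ℓ u₂ → D (ℓ u₂) (ℓ u₂) ≡ adj H u₁ u₂
  repeated-letter-loop {u₁} {u₂} {u₃} t₁₂ t₂₃ t₁₃ p₁<p₂ p₂<p₃ v v≢u₂ ℓv≡ℓu₂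
    with ≢⇒<⊎> (v≢u₂ ∘ permute-injective π)
  ... | inj₁ pv<p₂ = begin
    D (ℓ u₂) (ℓ u₂)  ≡⟨ cong (λ a → D a (ℓ u₂)) (≡.sym ℓv≡ℓu₂) ⟩
    D (ℓ v) (ℓ u₂)   ≡⟨ ≡.sym (decode rep v u₂ pv<p₂) ⟩
    adj H v u₂       ≡⟨ sym H v u₂ ⟩
    adj H u₂ v       ≡⟨ t₂₃ v v≢u₂ (ordered⇒≢ pv<p₃) ⟩
    adj H u₃ v       ≡⟨ sym H u₃ v ⟩
    adj H v u₃       ≡⟨ decode rep v u₃ pv<p₃ ⟩
    D (ℓ v) (ℓ u₃)   ≡⟨ cong (λ a → D a (ℓ u₃)) ℓv≡ℓu₂ ⟩
    D (ℓ u₂) (ℓ u₃)  ≡⟨ ≡.sym (decode rep u₂ u₃ p₂<p₃) ⟩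
    adj H u₂ u₃      ≡⟨ sym H u₂ u₃ ⟩
    adj H u₃ u₂      ≡⟨ ≡.sym (t₁₃ u₂ (ordered⇒≢ p₁<p₂ ∘ ≡.sym) (ordered⇒≢ p₂<p₃)) ⟩
    adj H u₁ u₂      ∎
    where
    open ≡.≡-Reasoning
    pv<p₃ : pos v <ᶠ pos u₃
    pv<p₃ = <-trans pv<p₂ p₂<p₃
  ... | inj₂ p₂<pv = begin
    D (ℓ u₂) (ℓ u₂)  ≡⟨ cong (D (ℓ u₂)) (≡.sym ℓv≡ℓu₂) ⟩
    D (ℓ u₂) (ℓ v)   ≡⟨ ≡.sym (decode rep u₂ v p₂<pv) ⟩
    adj H u₂ v       ≡⟨ ≡.sym (t₁₂ v (ordered⇒≢ p₁<pv ∘ ≡.sym) v≢u₂) ⟩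
    adj H u₁ v       ≡⟨ decode rep u₁ v p₁<pv ⟩
    D (ℓ u₁) (ℓ v)   ≡⟨ cong (D (ℓ u₁)) ℓv≡ℓu₂ ⟩
    D (ℓ u₁) (ℓ u₂)  ≡⟨ ≡.sym (decode rep u₁ u₂ p₁<p₂) ⟩
    adj H u₁ u₂      ∎
    where
    open ≡.≡-Reasoning
    p₁<pv : pos u₁ <ᶠ pos v
    p₁<pv = <-trans p₁<p₂ p₂<pv

module _ {G : Graph (suc m)} {x y} {D : Decoder k} {ℓ π}
         (rep : Represents (delete G x) D ℓ π) (twin : Twins G x (punchIn x y))
         (loop : D (ℓ y) (ℓ y) ≡ adj G x (punchIn x y)) where

  private
    j : Fin (suc m)
    j = suc (π ⟨$⟩ʳ y)

    twin-at : ∀ w → w ≢ y → adj G x (punchIn x w) ≡ adj G (punchIn x y) (punchIn x w)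
    twin-at w w≢y = twin (punchIn x w) (punchInᵢ≢i x w) (w≢y ∘ punchIn-injective x w y)

    x-first : ∀ w → j <ᶠ punchIn j (π ⟨$⟩ʳ w) → adj G x (punchIn x w) ≡ D (ℓ y) (ℓ w)
    x-first w j<πw with w ≟ y
    ... | yes refl = ≡.sym loop
    ... | no w≢y   = trans (twin-at w w≢y) (decode rep y w (<-punchIn⇒≤ j (π ⟨$⟩ʳ w) j<πw))

    x-last : ∀ w → punchIn j (π ⟨$⟩ʳ w) <ᶠ j → adj G (punchIn x w) x ≡ D (ℓ w) (ℓ y)
    x-last w πw<j with w ≟ y
    ... | yes refl = trans (sym G (punchIn x y) x) (≡.sym loop)
    ... | no w≢y   = begin
      adj G (punchIn x w) x               ≡⟨ sym G (punchIn x w) x ⟩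
      adj G x (punchIn x w)               ≡⟨ twin-at w w≢y ⟩
      adj G (punchIn x y) (punchIn x w)   ≡⟨ sym G (punchIn x y) (punchIn x w) ⟩
      adj G (punchIn x w) (punchIn x y)   ≡⟨ decode rep w y πw<πy ⟩
      D (ℓ w) (ℓ y)                       ∎
      where
      open ≡.≡-Reasoning
      πw<πy : π ⟨$⟩ʳ w <ᶠ π ⟨$⟩ʳ y
      πw<πy = ≤∧≢⇒< (ℕ.s≤s⁻¹ (punchIn-<⇒< j (π ⟨$⟩ʳ w) πw<j))
                    (w≢y ∘ permute-injective π)

    π⁺ : Permutation (suc m) (suc m)
    π⁺ = insert x j π

    ℓ⁺ : Fin (suc m) → Fin k
    ℓ⁺ = insertAt ℓ x (ℓ y)

    decode⁺ : ∀ u v → π⁺ ⟨$⟩ʳ u <ᶠ π⁺ ⟨$⟩ʳ v → adj G u v ≡ D (ℓ⁺ u) (ℓ⁺ v)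
    decode⁺ u v πu<πv with punchInView x u | punchInView x v
    ... | at | at = contradiction πu<πv (<-irrefl refl)
    ... | at | punched w rewrite insertAt-lookup ℓ x (ℓ y) | insertAt-punchIn ℓ x (ℓ y) w =
      x-first w (subst₂ _<ᶠ_ (insert-lookup x j π) (insert-punchIn x j π w) πu<πv)
    ... | punched w | at rewrite insertAt-punchIn ℓ x (ℓ y) w | insertAt-lookup ℓ x (ℓ y) =
      x-last w (subst₂ _<ᶠ_ (insert-punchIn x j π w) (insert-lookup x j π) πu<πv)
    ... | punched w₁ | punched w₂
      rewrite insertAt-punchIn ℓ x (ℓ y) w₁ | insertAt-punchIn ℓ x (ℓ y) w₂ =
      decode rep w₁ w₂ (punchIn-cancel-< j
        (subst₂ _<ᶠ_ (insert-punchIn x j π w₁) (insert-punchIn x j π w₂) πu<πv))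

  represents-insertTwin : Represents G D (insertAt ℓ x (ℓ y)) (insert x (suc (π ⟨$⟩ʳ y)) π)
  represents-insertTwin = represents decode⁺

PairwiseTwins : Graph n → Subset n → Set
PairwiseTwins G X = ∀ a b → a ∈ X → b ∈ X → Twins G a b

twins-delete : ∀ {G : Graph (suc m)} {x a b} →
  Twins G (punchIn x a) (punchIn x b) → Twins (delete G x) a b
twins-delete {x = x} {a} {b} twin z z≢a z≢b =
  twin (punchIn x z) (z≢a ∘ punchIn-injective x z a) (z≢b ∘ punchIn-injective x z b)

isLetterGraph-delete : ∀ (G : Graph (suc m)) x → IsLetterGraph G k → IsLetterGraph (delete G x) k
isLetterGraph-delete G x (D , G-over-D) =
  let (ℓ , π , rep) = isLetterGraphOver⇒represents {G = G} {D} G-over-D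
  in D , represents⇒isLetterGraphOver (represents-delete rep x)

module _ {G : Graph (suc m)} {X x} (twins : PairwiseTwins G X) (x∈X : x ∈ X)
         {D : Decoder k} {ℓ π} (rep : Represents (delete G x) D ℓ π) where

  private
    twinsH : ∀ {a b} → punchIn x a ∈ X → punchIn x b ∈ X → Twins (delete G x) a b
    twinsH a∈X b∈X = twins-delete {G = G} (twins _ _ a∈X b∈X)

  represents-undelete : ∀ u₁ u₂ u₃ → punchIn x u₁ ∈ X → punchIn x u₂ ∈ X → punchIn x u₃ ∈ X →
    π ⟨$⟩ʳ u₁ <ᶠ π ⟨$⟩ʳ u₂ → π ⟨$⟩ʳ u₂ <ᶠ π ⟨$⟩ʳ u₃ →
    Represents G (withLoop D (ℓ u₂) (adj G (punchIn x u₁) (punchIn x u₂)))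
                 (insertAt ℓ x (ℓ u₂)) (insert x (suc (π ⟨$⟩ʳ u₂)) π)
  represents-undelete u₁ u₂ u₃ u₁∈X u₂∈X u₃∈X p₁<p₂ p₂<p₃ =
    represents-insertTwin rep′ (twins x (punchIn x u₂) x∈X u₂∈X) loop
    where
    ε : Bool
    ε = adj G (punchIn x u₁) (punchIn x u₂)

    rep′ : Represents (delete G x) (withLoop D (ℓ u₂) ε) ℓ π
    rep′ = represents-withLoop rep (repeated-letter-loop rep
      (twinsH u₁∈X u₂∈X) (twinsH u₂∈X u₃∈X) (twinsH u₁∈X u₃∈X) p₁<p₂ p₂<p₃)

    u₂≢u₁ : punchIn x u₂ ≢ punchIn x u₁
    u₂≢u₁ = <⇒≢ p₁<p₂ ∘ cong (π ⟨$⟩ʳ_) ∘ ≡.sym ∘ punchIn-injective x u₂ u₁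

    loop : withLoop D (ℓ u₂) ε (ℓ u₂) (ℓ u₂) ≡ adj G x (punchIn x u₂)
    loop = trans (withLoop-loop D (ℓ u₂) ε)
                 (≡.sym (twins x (punchIn x u₁) x∈X u₁∈X (punchIn x u₂) (punchInᵢ≢i x u₂) u₂≢u₁))

isLetterGraph-undelete : ∀ (G : Graph (suc m)) {X x} → PairwiseTwins G X → x ∈ X → 4 ≤ ∣ X ∣ →
  IsLetterGraph (delete G x) k → IsLetterGraph G k
isLetterGraph-undelete G {X} {x} twins x∈X 4≤∣X∣ (D , H-over-D) =
  let (ℓ , π , rep) = isLetterGraphOver⇒represents {G = delete G x} {D} H-over-D
      (a , b , c , a∈X , b∈X , c∈X , a≢b , b≢c , a≢c) = three-others X x 4≤∣X∣
      (u₁ , u₂ , u₃ , u₁∈X , u₂∈X , u₃∈X , p₁<p₂ , p₂<p₃) =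
        sort3 {P = λ u → punchIn x u ∈ X} (π ⟨$⟩ʳ_) a∈X b∈X c∈X
          (a≢b ∘ permute-injective π) (b≢c ∘ permute-injective π) (a≢c ∘ permute-injective π)
  in withLoop D (ℓ u₂) (adj G (punchIn x u₁) (punchIn x u₂)) ,
     represents⇒isLetterGraphOver
       (represents-undelete {G = G} twins x∈X rep u₁ u₂ u₃ u₁∈X u₂∈X u₃∈X p₁<p₂ p₂<p₃)

hasLettericity-cong : ∀ (G : Graph m) (H : Graph n) →
  (∀ j → IsLetterGraph G j ⇔ IsLetterGraph H j) → HasLettericity G k ⇔ HasLettericity H k
hasLettericity-cong _ _ G⇔H = mk⇔
  (λ (G-k , G-min) → Equivalence.to (G⇔H _) G-k , λ j → G-min j ∘ Equivalence.from (G⇔H j))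
  (λ (H-k , H-min) → Equivalence.from (G⇔H _) H-k , λ j → H-min j ∘ Equivalence.to (G⇔H j))

lemma4p1 : ∀ {m} (G : Graph (suc m)) (X : Subset (suc m)) →
    IsTwinClass G X → 4 ≤ ∣ X ∣ →
    ∀ x → x ∈ X → ∀ k → HasLettericity G k ⇔ HasLettericity (delete G x) k
lemma4p1 G X (_ , twins , _) 4≤∣X∣ x x∈X k =
  hasLettericity-cong G (delete G x) λ j →
  mk⇔ (isLetterGraph-delete G x) (isLetterGraph-undelete G twins x∈X 4≤∣X∣)
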